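{- Let $\mathcal M$ be a CGM with agent set $\Sigma$, $s$ a state of $\mathcal M$, and $\Phi=\{\langle\langle A_1\rangle\rangle\bigcirc\varphi_1,\dots,\langle\langle A_m\rangle\rangle\bigcirc\varphi_m,\neg\langle\langle A'\rangle\rangle\bigcirc\psi\}$ a set of ATL-formulae with $A_i\cap A_j=\emptyset$ for all $1\le i\ne j\le m$ and $A_i\subseteq A'$ for all $1\le i\le m$, such that $\mathcal M,s\Vdash\Phi$. For each $i$ let $\sigma_{A_i}$ be an $A_i$-move at $s$ witnessing the truth of $\langle\langle A_i\rangle\rangle\bigcirc\varphi_i$ at $s$ (i.e. $\varphi_i$ holds at every state of $out(s,\sigma_{A_i})$), and let $c_{A'}$ be a co-$A'$-move at $s$ witnessing the truth of $\neg\langle\langle A'\rangle\rangle\bigcirc\psi$ at $s$ (i.e. $\neg\psi$ holds at every state of $out(s,c_{A'})$). Then there exists $s'\in out(s,\sigma_{A_1})\cap\dots\cap out(s,\sigma_{A_m})\cap out(s,c_{A'})$ with $\mathcal M,s'\Vdash\{\varphi_1,\dots,\varphi_m,\neg\psi\}$.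
   Context: A CGM is $(\Sigma,S,d,\delta,AP,L)$ with $S\ne\emptyset$, moves $D_a(s)=\{0,\dots,d_a(s)-1\}$ ($d_a(s)\ge1$) for agent $a\in\Sigma$ at $s$, move vectors $D(s)=\prod_{a\in\Sigma}D_a(s)$, transition $\delta(s,\sigma)\in S$, and labeling $L$. For $A\subseteq\Sigma$, an $A$-move at $s$ picks a move in $D_a(s)$ for each $a\in A$; a move vector extends it if it agrees with it on $A$; $out(s,\sigma_A)=\{\delta(s,\sigma):\sigma\in D(s)\text{ extends }\sigma_A\}$. A co-$A$-move at $s$ is a function $c$ from the set of $A$-moves at $s$ to $D(s)$ such that $c(\sigma_A)$ extends $\sigma_A$ for every $A$-move $\sigma_A$; $out(s,c)=\{\delta(s,c(\sigma_A)):\sigma_A\text{ an }A\text{ -move at }s\}$. The formula $\langle\langle A\rangle\rangle\bigcirc\varphi$ is true at $s$ iff some $A$-move $\sigma_A$ at $s$ has $\varphi$ true at every state of $out(s,\sigma_A)$; $\neg$ is classical negation. -}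

module Defs where

open import Data.Nat using (ℕ; _≤_)
open import Data.Fin using (Fin)
open import Data.Fin.Subset using (Subset; _∈_)
open import Data.Bool using (Bool)
open import Data.Product using (Σ; ∃; _×_)
open import Relation.Binary.PropositionalEquality using (_≡_)

record CGM (k : ℕ) : Set₁ where
  field
    S     : Set
    s₀    : S                        -- S ≠ ∅
    d     : S → Fin k → ℕ
    d≥1   : ∀ s a → 1 ≤ d s a
    AP    : Set
    L     : S → AP → Bool
  -- D_a(s) = Fin (d s a);  D(s) = move vectors
  MoveVec : S → Set
  MoveVec s = (a : Fin k) → Fin (d s a)
  field
    δ     : (s : S) → MoveVec s → S

module _ {k : ℕ} (M : CGM k) where
  open CGM M

  AMove : Subset k → S → Set
  AMove A s = (a : Fin k) → a ∈ A → Fin (d s a)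

  Extends : {A : Subset k} {s : S} → MoveVec s → AMove A s → Set
  Extends {A} σ σA = ∀ a (p : a ∈ A) → σ a ≡ σA a p

  CoMove : Subset k → S → Set
  CoMove A s = Σ (AMove A s → MoveVec s) λ c → ∀ σA → Extends (c σA) σA

  InOut : {A : Subset k} (s : S) → AMove A s → S → Set
  InOut s σA t = ∃ λ (σ : MoveVec s) → Extends σ σA × δ s σ ≡ t

  InOutCo : {A : Subset k} (s : S) → CoMove A s → S → Set
  InOutCo {A} s c t = ∃ λ (σA : AMove A s) → δ s (Data.Product.proj₁ c σA) ≡ t

  -- semantics of ⟨⟨A⟩⟩○φ, with φ given by its truth set
  Next : Subset k → (S → Set) → S → Set
  Next A φ s = ∃ λ (σA : AMove A s) → ∀ t → InOut s σA t → φ t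

-- The witnessing moves σᵢ live on pairwise disjoint coalitions, so they merge
-- into one move vector v extending all of them (agents outside every Aᵢ play 0).
-- Restricted to A′, v is an A′-move; the co-move answers it with c(v|A′), which
-- extends v|A′ and hence every σᵢ because Aᵢ ⊆ A′. Its successor s′ therefore
-- lies in every out(s, σᵢ) and in out(s, c), and the witnesses give φᵢ and ¬ψ there.
module Submission where

open import Defs
open import Data.Nat using (ℕ)
open import Data.Fin using (Fin; fromℕ<)
open import Data.Fin.Properties using (any?; _≟_)
open import Data.Fin.Subset using (Subset; _∈_; _⊆_)
open import Data.Fin.Subset.Properties using (_∈?_)
open import Data.Vec.Properties.WithK using ([]=-irrelevant)
open import Data.Product using (∃; _×_; proj₁; _,_)
open import Data.Empty using (⊥; ⊥-elim)
open import Relation.Nullary using (¬_; yes; no)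
open import Relation.Binary.PropositionalEquality using (_≢_; refl; trans; cong)

module _ {k : ℕ} (M : CGM k) where
  open CGM M

  restrict : {s : S} (A : Subset k) → MoveVec s → AMove M A s
  restrict A v a _ = v a

  defaultMove : (s : S) → MoveVec s
  defaultMove s a = fromℕ< (d≥1 s a)

  module _ {m : ℕ} {A : Fin m → Subset k}
           (disjoint : ∀ i j → i ≢ j → ∀ a → a ∈ A i → a ∈ A j → ⊥)
           {s : S} (σ : (i : Fin m) → AMove M (A i) s) where

    merge : MoveVec s
    merge a with any? (λ j → a ∈? A j)
    ... | yes (j , a∈Aj) = σ j a a∈Aj
    ... | no _           = defaultMove s a

    merge-extends : ∀ i → Extends M merge (σ i)
    merge-extends i a a∈Ai with any? (λ j → a ∈? A j)
    ... | no a∉⋃A = ⊥-elim (a∉⋃A (i , a∈Ai))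
    ... | yes (j , a∈Aj) with j ≟ i
    ...   | yes refl = cong (σ i a) ([]=-irrelevant a∈Aj a∈Ai)
    ...   | no j≢i   = ⊥-elim (disjoint j i j≢i a a∈Aj a∈Ai)

  coMove-answer-∈-out : {s : S} {A B : Subset k} → A ⊆ B →
    (c : CoMove M B s) (v : MoveVec s) (σA : AMove M A s) → Extends M v σA →
    InOut M s σA (δ s (proj₁ c (restrict B v)))
  coMove-answer-∈-out A⊆B (c , c-extends) v σA v-extends =
    c (restrict _ v) ,
    (λ a a∈A → trans (c-extends (restrict _ v) a (A⊆B a∈A)) (v-extends a a∈A)) ,
    refl

-- The truth of Φ at s enters only through the witnesses σ and c.
mainTheorem8 : ∀ {k : ℕ} (M : CGM k) (s : CGM.S M) (m : ℕ)
    (A : Fin m → Subset k) (A′ : Subset k)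
    (φ : Fin m → CGM.S M → Set) (ψ : CGM.S M → Set)
    → (∀ i j → i ≢ j → ∀ a → a ∈ A i → a ∈ A j → ⊥)
    → (∀ i → A i ⊆ A′)
    → (∀ i → Next M (A i) (φ i) s)
    → ¬ Next M A′ ψ s
    → (σ : (i : Fin m) → AMove M (A i) s)
    → (∀ i t → InOut M s (σ i) t → φ i t)
    → (c : CoMove M A′ s)
    → (∀ t → InOutCo M s c t → ¬ ψ t)
    → ∃ λ (s′ : CGM.S M) →
    (∀ i → InOut M s (σ i) s′) × InOutCo M s c s′
    × (∀ i → φ i s′) × ¬ ψ s′
mainTheorem8 M s m A A′ φ ψ disjoint Ai⊆A′ _ _ σ σ-wins c c-wins =
  s′ , s′∈outσ , s′∈outc , (λ i → σ-wins i s′ (s′∈outσ i)) , c-wins s′ s′∈outc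
  where
  τ : AMove M A′ s
  τ = restrict M A′ (merge M disjoint σ)
  s′ : CGM.S M
  s′ = CGM.δ M s (proj₁ c τ)

  s′∈outc : InOutCo M s c s′
  s′∈outc = τ , refl

  s′∈outσ : ∀ i → InOut M s (σ i) s′
  s′∈outσ i = coMove-answer-∈-out M (Ai⊆A′ i) c (merge M disjoint σ) (σ i)
                (merge-extends M disjoint σ i)
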